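{- For each $n\ge 3$ let $G_n$ be the straight linear 2-tree on $n$ vertices and let $H_n$ be any connected subgraph of $G_n$ containing vertices $1$ and $n$. Then \[ \lim_{n\to\infty} r_{H_n}(1,n)=\infty . \]
   Context: The straight linear 2-tree $G_n$ is the graph with vertex set $\{1,\dots,n\}$ in which $\{i,j\}$ is an edge if and only if $0<|i-j|\le 2$. Every edge is a unit resistor; for a connected graph $H$, $r_H(i,j)=(\mathbf e_i-\mathbf e_j)^TL(H)^{\dagger}(\mathbf e_i-\mathbf e_j)$ denotes the resistance distance, where $L(H)^\dagger$ is the Moore–Penrose inverse of the Laplacian of $H$. -}

module Defs where

open import Data.Nat as ℕ using (ℕ; zero; suc; ∣_-_∣)
open import Data.Fin as Fin using (Fin; toℕ)
open import Data.Bool using (Bool; true; false; T; if_then_else_)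
open import Data.Product using (_×_)
open import Data.Rational as ℚ using (ℚ; 0ℚ; 1ℚ; _+_; _*_; _-_)
open import Relation.Nullary.Decidable using (⌊_⌋)
open import Relation.Binary.PropositionalEquality using (_≡_)
open import Function.Definitions using (Injective)

-- Vertices 1..n of G_n are represented by Fin n (vertex i ↦ i-1).

GAdj : {n : ℕ} → Fin n → Fin n → Set
GAdj i j = (0 ℕ.< ∣ toℕ i - toℕ j ∣) × (∣ toℕ i - toℕ j ∣ ℕ.≤ 2)

data Reach {m : ℕ} (adj : Fin m → Fin m → Bool) : Fin m → Fin m → Set where
  here : ∀ {a} → Reach adj a a
  step : ∀ {a b c} → T (adj a b) → Reach adj b c → Reach adj a c

-- A connected subgraph H of G_n containing vertices 1 and n.
-- H has vertex set Fin m, embedded injectively into V(G_n) by emb;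
-- its edges (adj, symmetric) are edges of G_n.
record ConnSubgraph (n : ℕ) : Set where
  field
    m         : ℕ
    emb       : Fin m → Fin n
    emb-inj   : Injective _≡_ _≡_ emb
    adj       : Fin m → Fin m → Bool
    adj-sym   : ∀ a b → adj a b ≡ adj b a
    adj-sub   : ∀ a b → T (adj a b) → GAdj (emb a) (emb b)
    connected : ∀ a b → Reach adj a b
    s         : Fin m
    s-first   : toℕ (emb s) ≡ 0          -- vertex 1 of G_n
    t         : Fin m
    t-last    : suc (toℕ (emb t)) ≡ n    -- vertex n of G_n

Σ : (m : ℕ) → (Fin m → ℚ) → ℚ
Σ zero    f = 0ℚ
Σ (suc m) f = f Fin.zero + Σ m (λ i → f (Fin.suc i))

Matrix : ℕ → Set
Matrix m = Fin m → Fin m → ℚ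

infixl 7 _·_
infix 4 _≈ₘ_
_·_ : {m : ℕ} → Matrix m → Matrix m → Matrix m
_·_ {m} A B i j = Σ m (λ k → A i k * B k j)

transpose : {m : ℕ} → Matrix m → Matrix m
transpose A i j = A j i

_≈ₘ_ : {m : ℕ} → Matrix m → Matrix m → Set
A ≈ₘ B = ∀ i j → A i j ≡ B i j

-- Moore–Penrose conditions (real matrices: conjugate transpose = transpose).
IsMPInverse : {m : ℕ} → Matrix m → Matrix m → Set
IsMPInverse L X =
  ((L · X) · L ≈ₘ L) × ((X · L) · X ≈ₘ X) ×
  (transpose (L · X) ≈ₘ L · X) × (transpose (X · L) ≈ₘ X · L)

indicator : Bool → ℚ
indicator b = if b then 1ℚ else 0ℚ

eqF : {m : ℕ} → Fin m → Fin m → Bool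
eqF i j = ⌊ i Fin.≟ j ⌋

laplacian : {m : ℕ} → (Fin m → Fin m → Bool) → Matrix m
laplacian {m} adj i j =
  indicator (eqF i j) * Σ m (λ k → indicator (adj i k)) - indicator (adj i j)

quadForm : {m : ℕ} → Matrix m → Fin m → Fin m → ℚ
quadForm {m} X a b = Σ m (λ i → Σ m (λ j → u i * X i j * u j))
  where
  u : Fin _ → ℚ
  u i = indicator (eqF i a) - indicator (eqF i b)

module _ {n : ℕ} (H : ConnSubgraph n) where
  open ConnSubgraph H
  L[_] : Matrix m
  L[_] = laplacian adj

  resistance1n : Matrix m → ℚ
  resistance1n X = quadForm X s t

module Submission where

-- Thomson's principle. Write u = e_s − e_t and y = X u. The conditions L X L = L and (L X)ᵀ = L X
-- make u − L y harmonic, hence constant on the connected graph H, and it sums to zero, so L y = u.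
-- For the Dirichlet form D(g, h) = Σ_{i,j} A_ij (g_i − g_j)(h_i − h_j) = 2 ⟨g, L h⟩ this gives
-- D(f, y) = 2 (f s − f t) and D(y, y) = 2 r, and AM-GM yields 4 (f s − f t) ≤ D(f, f) + 2 r for
-- every potential f. Take f = −position/8: its drop from vertex 1 to vertex n is (n − 1)/8, while
-- every vertex of G_n has at most four neighbours, each at distance at most 2, so D(f, f) ≤ n/4.
-- Hence r_{H_n}(1, n) ≥ (n − 2)/8.

open import Defs
open import Data.Nat using (ℕ; _≤_)
open import Data.Product using (∃-syntax)
open import Data.Rational using (ℚ) renaming (_≤_ to _≤ℚ_)

open import Algebra.Bundles using (Ring)
open import Data.Bool using (Bool; true; false; T)
open import Data.Empty using (⊥-elim)
open import Data.Fin as Fin using (Fin; toℕ)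
open import Data.Fin.Patterns using (0F; 1F; 2F; 3F)
import Data.Fin.Properties as Fin
import Data.Integer as ℤ
import Data.Integer.Properties as ℤ
open import Data.Nat as ℕ using (zero; suc; z≤n; s≤s; _≡ᵇ_)
import Data.Nat.Properties as ℕ
open import Data.Product using (_×_; _,_; proj₁; proj₂)
open import Data.Rational as ℚ using (mkℚ; 0ℚ; 1ℚ; ½; _+_; _*_; _-_; -_; 1/_)
import Data.Rational.Properties as ℚ
open import Data.Rational.Solver using (module +-*-Solver)
import Data.Rational.Unnormalised as ℚᵘ
import Data.Rational.Unnormalised.Properties as ℚᵘ
open import Data.Sum using (inj₁; inj₂)
open import Data.Unit using (tt)
open import Data.Vec.Functional using (Vector)
open import Function.Definitions using (Injective)
open import Relation.Binary.Definitions using (tri<; tri≈; tri>)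
open import Relation.Binary.PropositionalEquality
open import Relation.Nullary using (yes; no)

open +-*-Solver

2ℚ : ℚ
2ℚ = 1ℚ + 1ℚ

0≤q-p⇒p≤q : ∀ {p q} → 0ℚ ≤ℚ q - p → p ≤ℚ q
0≤q-p⇒p≤q {p} {q} 0≤q-p = subst₂ _≤ℚ_ (ℚ.+-identityʳ p)
  (solve 2 (λ p q → p :+ (q :- p) := q) refl p q) (ℚ.+-monoʳ-≤ p 0≤q-p)

p≤q⇒0≤q-p : ∀ {p q} → p ≤ℚ q → 0ℚ ≤ℚ q - p
p≤q⇒0≤q-p {p} {q} p≤q = subst (_≤ℚ q - p) (ℚ.+-inverseʳ p) (ℚ.+-monoˡ-≤ (- p) p≤q)

p≤p+q : ∀ p {q} → 0ℚ ≤ℚ q → p ≤ℚ p + q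
p≤p+q p {q} 0≤q = subst (_≤ℚ p + q) (ℚ.+-identityʳ p) (ℚ.+-monoʳ-≤ p 0≤q)

p≤q+p : ∀ p {q} → 0ℚ ≤ℚ q → p ≤ℚ q + p
p≤q+p p {q} 0≤q = subst (_≤ℚ q + p) (ℚ.+-identityˡ p) (ℚ.+-monoˡ-≤ p 0≤q)

+-nonNeg : ∀ {p q} → 0ℚ ≤ℚ p → 0ℚ ≤ℚ q → 0ℚ ≤ℚ p + q
+-nonNeg = ℚ.+-mono-≤

*-nonNeg : ∀ {p q} → 0ℚ ≤ℚ p → 0ℚ ≤ℚ q → 0ℚ ≤ℚ p * q
*-nonNeg {p} {q} 0≤p 0≤q =
  ℚ.nonNegative⁻¹ (p * q) {{ℚ.nonNeg*nonNeg⇒nonNeg p {{ℚ.nonNegative 0≤p}} q {{ℚ.nonNegative 0≤q}}}}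

nonNeg-+≡0⇒≡0 : ∀ {p q} → 0ℚ ≤ℚ p → 0ℚ ≤ℚ q → p + q ≡ 0ℚ → p ≡ 0ℚ × q ≡ 0ℚ
nonNeg-+≡0⇒≡0 {p} {q} 0≤p 0≤q p+q≡0 =
  ℚ.≤-antisym (subst₂ _≤ℚ_ (ℚ.+-identityʳ p) p+q≡0 (ℚ.+-monoʳ-≤ p 0≤q)) 0≤p ,
  ℚ.≤-antisym (subst₂ _≤ℚ_ (ℚ.+-identityˡ q) p+q≡0 (ℚ.+-monoˡ-≤ q 0≤p)) 0≤q

+-*-cancelˡ-≤ : ∀ a c .{{_ : ℚ.Positive c}} {p q} → a + c * p ≤ℚ a + c * q → p ≤ℚ q
+-*-cancelˡ-≤ a c {p} {q} a+cp≤a+cq =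
  ℚ.*-cancelˡ-≤-pos c (subst₂ _≤ℚ_ (cancel p) (cancel q) (ℚ.+-monoʳ-≤ (- a) a+cp≤a+cq))
  where
  cancel : ∀ x → - a + (a + c * x) ≡ c * x
  cancel x = solve 3 (λ a c x → :- a :+ (a :+ c :* x) := c :* x) refl a c x

square-nonNeg : ∀ p → 0ℚ ≤ℚ p * p
square-nonNeg p with ℚ.≤-total 0ℚ p
... | inj₁ 0≤p = *-nonNeg 0≤p 0≤p
... | inj₂ p≤0 =
  ℚ.nonNegative⁻¹ (p * p) {{ℚ.nonPos*nonPos⇒nonPos p {{ℚ.nonPositive p≤0}} p {{ℚ.nonPositive p≤0}}}}

square≡0⇒≡0 : ∀ p → p * p ≡ 0ℚ → p ≡ 0ℚ
square≡0⇒≡0 p p²≡0 with ℚ.<-cmp p 0ℚ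
... | tri≈ _ p≡0 _ = p≡0
... | tri< p<0 _ _ = ⊥-elim (ℚ.<-irrefl (sym p²≡0)
        (ℚ.positive⁻¹ _ {{ℚ.neg*neg⇒pos p {{ℚ.negative p<0}} p {{ℚ.negative p<0}}}}))
... | tri> _ _ 0<p = ⊥-elim (ℚ.<-irrefl (sym p²≡0)
        (ℚ.positive⁻¹ _ {{ℚ.pos*pos⇒pos p {{ℚ.positive 0<p}} p {{ℚ.positive 0<p}}}}))

2pq≤p²+q² : ∀ p q → 2ℚ * (p * q) ≤ℚ p * p + q * q
2pq≤p²+q² p q = 0≤q-p⇒p≤q (subst (0ℚ ≤ℚ_)
  (solve 2 (λ p q → (p :- q) :* (p :- q) := (p :* p :+ q :* q) :- con 2ℚ :* (p :* q)) refl p q)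
  (square-nonNeg (p - q)))

fromℕ : ℕ → ℚ
fromℕ zero    = 0ℚ
fromℕ (suc k) = 1ℚ + fromℕ k

fromℕ-+ : ∀ k l → fromℕ (k ℕ.+ l) ≡ fromℕ k + fromℕ l
fromℕ-+ zero    l = sym (ℚ.+-identityˡ (fromℕ l))
fromℕ-+ (suc k) l = trans (cong (1ℚ +_) (fromℕ-+ k l)) (sym (ℚ.+-assoc 1ℚ (fromℕ k) (fromℕ l)))

fromℕ-* : ∀ k l → fromℕ (k ℕ.* l) ≡ fromℕ k * fromℕ l
fromℕ-* zero    l = sym (ℚ.*-zeroˡ (fromℕ l))
fromℕ-* (suc k) l = begin
  fromℕ (l ℕ.+ k ℕ.* l)         ≡⟨ fromℕ-+ l (k ℕ.* l) ⟩
  fromℕ l + fromℕ (k ℕ.* l)     ≡⟨ cong (fromℕ l +_) (fromℕ-* k l) ⟩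
  fromℕ l + fromℕ k * fromℕ l   ≡⟨ solve 2 (λ k l → l :+ k :* l := (con 1ℚ :+ k) :* l) refl (fromℕ k) _ ⟩
  (1ℚ + fromℕ k) * fromℕ l      ∎
  where open ≡-Reasoning

fromℕ-nonNeg : ∀ k → 0ℚ ≤ℚ fromℕ k
fromℕ-nonNeg zero    = ℚ.≤-refl
fromℕ-nonNeg (suc k) = ℚ.+-mono-≤ {0ℚ} {1ℚ} (ℚ.≤ᵇ⇒≤ tt) (fromℕ-nonNeg k)

fromℕ-mono-≤ : ∀ {k l} → k ≤ l → fromℕ k ≤ℚ fromℕ l
fromℕ-mono-≤ {l = l} z≤n = fromℕ-nonNeg l
fromℕ-mono-≤ (s≤s k≤l) = ℚ.+-monoʳ-≤ 1ℚ (fromℕ-mono-≤ k≤l)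

toℚᵘ-fromℕ : ∀ k → ℚ.toℚᵘ (fromℕ k) ℚᵘ.≃ ℚᵘ.mkℚᵘ (ℤ.+ k) 0
toℚᵘ-fromℕ zero    = ℚᵘ.≃-refl
toℚᵘ-fromℕ (suc k) = ℚᵘ.≃-trans (ℚ.toℚᵘ-homo-+ 1ℚ (fromℕ k))
  (ℚᵘ.≃-trans (ℚᵘ.+-congʳ (ℚ.toℚᵘ 1ℚ) (toℚᵘ-fromℕ k)) (ℚᵘ.*≡* numerators))
  where
  numerators : (ℤ.1ℤ ℤ.+ ℤ.+ k ℤ.* ℤ.1ℤ) ℤ.* ℤ.1ℤ ≡ ℤ.+ suc k ℤ.* ℤ.1ℤ
  numerators = cong (λ z → (ℤ.1ℤ ℤ.+ z) ℤ.* ℤ.1ℤ) (ℤ.*-identityʳ (ℤ.+ k))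

fromℕ-unbounded : ∀ p → ∃[ k ] p ≤ℚ fromℕ k
fromℕ-unbounded p@(mkℚ ℤ.-[1+ _ ] _ _) = 0 , ℚ.<⇒≤ (ℚ.negative⁻¹ p)
fromℕ-unbounded (mkℚ (ℤ.+ k) _ _) = k , ℚ.toℚᵘ-cancel-≤ (ℚᵘ.≤-respʳ-≃ (ℚᵘ.≃-sym (toℚᵘ-fromℕ k))
  (ℚᵘ.*≤* (ℤ.*-monoˡ-≤-nonNeg (ℤ.+ k) (ℤ.+≤+ (s≤s z≤n)))))

open import Algebra.Properties.Semiring.Sum (Ring.semiring ℚ.+-*-ring)
  using (sum; ∑-distrib-+; ∑-comm; *-distribˡ-sum; *-distribʳ-sum; sum-cong-≗; sum-replicate-zero)

Σ≡sum : ∀ m (f : Fin m → ℚ) → Σ m f ≡ sum f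
Σ≡sum zero    f = refl
Σ≡sum (suc m) f = cong (f Fin.zero +_) (Σ≡sum m (λ i → f (Fin.suc i)))

Σ-cong : ∀ m {f g : Fin m → ℚ} → (∀ i → f i ≡ g i) → Σ m f ≡ Σ m g
Σ-cong m {f} {g} f≗g rewrite Σ≡sum m f | Σ≡sum m g = sum-cong-≗ f≗g

Σ-+ : ∀ m (f g : Fin m → ℚ) → Σ m (λ i → f i + g i) ≡ Σ m f + Σ m g
Σ-+ m f g rewrite Σ≡sum m f | Σ≡sum m g | Σ≡sum m (λ i → f i + g i) = ∑-distrib-+ f g

Σ-*ˡ : ∀ m c (f : Fin m → ℚ) → Σ m (λ i → c * f i) ≡ c * Σ m f
Σ-*ˡ m c f rewrite Σ≡sum m f | Σ≡sum m (λ i → c * f i) = sym (*-distribˡ-sum c f)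

Σ-*ʳ : ∀ m c (f : Fin m → ℚ) → Σ m (λ i → f i * c) ≡ Σ m f * c
Σ-*ʳ m c f rewrite Σ≡sum m f | Σ≡sum m (λ i → f i * c) = sym (*-distribʳ-sum c f)

Σ-zero : ∀ m → Σ m (λ _ → 0ℚ) ≡ 0ℚ
Σ-zero m rewrite Σ≡sum m (λ _ → 0ℚ) = sum-replicate-zero m

Σ-comm : ∀ m k (f : Fin m → Fin k → ℚ) →
  Σ m (λ i → Σ k (f i)) ≡ Σ k (λ j → Σ m (λ i → f i j))
Σ-comm m k f = begin
  Σ m (λ i → Σ k (f i))             ≡⟨ trans (Σ-cong m (λ i → Σ≡sum k (f i))) (Σ≡sum m _) ⟩
  sum (λ i → sum (f i))             ≡⟨ ∑-comm f ⟩
  sum (λ j → sum (λ i → f i j))     ≡⟨ sym (trans (Σ-cong k (λ j → Σ≡sum m _)) (Σ≡sum k _)) ⟩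
  Σ k (λ j → Σ m (λ i → f i j))     ∎
  where open ≡-Reasoning

Σ-- : ∀ m (f g : Fin m → ℚ) → Σ m (λ i → f i - g i) ≡ Σ m f - Σ m g
Σ-- zero    f g = refl
Σ-- (suc m) f g = trans
  (cong (f Fin.zero - g Fin.zero +_) (Σ-- m (λ i → f (Fin.suc i)) (λ i → g (Fin.suc i))))
  (solve 4 (λ a b c d → (a :- b) :+ (c :- d) := (a :+ c) :- (b :+ d)) refl
    (f Fin.zero) (g Fin.zero) (Σ m (λ i → f (Fin.suc i))) (Σ m (λ i → g (Fin.suc i))))

Σ-const : ∀ m c → Σ m (λ _ → c) ≡ fromℕ m * c
Σ-const zero    c = sym (ℚ.*-zeroˡ c)
Σ-const (suc m) c = trans (cong (c +_) (Σ-const m c))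
  (solve 2 (λ c k → c :+ k :* c := (con 1ℚ :+ k) :* c) refl c (fromℕ m))

Σ-mono-≤ : ∀ m {f g : Fin m → ℚ} → (∀ i → f i ≤ℚ g i) → Σ m f ≤ℚ Σ m g
Σ-mono-≤ zero    f≤g = ℚ.≤-refl
Σ-mono-≤ (suc m) f≤g = ℚ.+-mono-≤ (f≤g Fin.zero) (Σ-mono-≤ m (λ i → f≤g (Fin.suc i)))

Σ-nonNeg : ∀ m {f : Fin m → ℚ} → (∀ i → 0ℚ ≤ℚ f i) → 0ℚ ≤ℚ Σ m f
Σ-nonNeg m 0≤f = subst (_≤ℚ Σ m _) (Σ-zero m) (Σ-mono-≤ m 0≤f)

Σ-term≤ : ∀ m {f : Fin m → ℚ} → (∀ i → 0ℚ ≤ℚ f i) → ∀ k → f k ≤ℚ Σ m f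
Σ-term≤ (suc m) 0≤f Fin.zero    = p≤p+q _ (Σ-nonNeg m (λ i → 0≤f (Fin.suc i)))
Σ-term≤ (suc m) 0≤f (Fin.suc k) =
  ℚ.≤-trans (Σ-term≤ m (λ i → 0≤f (Fin.suc i)) k) (p≤q+p _ (0≤f Fin.zero))

nonNeg-Σ≡0⇒≡0 : ∀ m {f : Fin m → ℚ} → (∀ i → 0ℚ ≤ℚ f i) → Σ m f ≡ 0ℚ → ∀ i → f i ≡ 0ℚ
nonNeg-Σ≡0⇒≡0 (suc m) 0≤f Σf≡0 i
  with nonNeg-+≡0⇒≡0 (0≤f Fin.zero) (Σ-nonNeg m (λ i → 0≤f (Fin.suc i))) Σf≡0
nonNeg-Σ≡0⇒≡0 (suc m) 0≤f Σf≡0 Fin.zero    | f₀≡0 , _     = f₀≡0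
nonNeg-Σ≡0⇒≡0 (suc m) 0≤f Σf≡0 (Fin.suc i) | _    , Σf′≡0 =
  nonNeg-Σ≡0⇒≡0 m (λ i → 0≤f (Fin.suc i)) Σf′≡0 i

indicator-nonNeg : ∀ b → 0ℚ ≤ℚ indicator b
indicator-nonNeg false = ℚ.≤-refl
indicator-nonNeg true  = ℚ.≤ᵇ⇒≤ tt

indicator-T : ∀ {b} → T b → indicator b ≡ 1ℚ
indicator-T {true} _ = refl

indicator-*-mono-≤ : ∀ b {p q} → p ≤ℚ q → indicator b * p ≤ℚ indicator b * q
indicator-*-mono-≤ b = ℚ.*-monoˡ-≤-nonNeg (indicator b) {{ℚ.nonNegative (indicator-nonNeg b)}}

eqF-suc : ∀ {m} (i j : Fin m) → eqF (Fin.suc i) (Fin.suc j) ≡ eqF i j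
eqF-suc i j with i Fin.≟ j
... | yes _ = refl
... | no  _ = refl

eqF-sym : ∀ {m} (i j : Fin m) → eqF i j ≡ eqF j i
eqF-sym i j with i Fin.≟ j | j Fin.≟ i
... | yes _    | yes _    = refl
... | no  _    | no  _    = refl
... | yes refl | no  i≢i  = ⊥-elim (i≢i refl)
... | no  i≢i  | yes refl = ⊥-elim (i≢i refl)

Σ-δ : ∀ m (a : Fin m) (f : Fin m → ℚ) → Σ m (λ i → indicator (eqF i a) * f i) ≡ f a
Σ-δ (suc m) Fin.zero f = begin
  1ℚ * f Fin.zero + Σ m (λ i → 0ℚ * f (Fin.suc i))
    ≡⟨ cong₂ _+_ (ℚ.*-identityˡ (f Fin.zero))
                 (trans (Σ-cong m (λ i → ℚ.*-zeroˡ (f (Fin.suc i)))) (Σ-zero m)) ⟩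
  f Fin.zero + 0ℚ
    ≡⟨ ℚ.+-identityʳ (f Fin.zero) ⟩
  f Fin.zero ∎
  where open ≡-Reasoning
Σ-δ (suc m) (Fin.suc a) f = begin
  0ℚ * f Fin.zero + Σ m (λ i → indicator (eqF (Fin.suc i) (Fin.suc a)) * f (Fin.suc i))
    ≡⟨ cong₂ _+_ (ℚ.*-zeroˡ (f Fin.zero))
                 (Σ-cong m (λ i → cong (λ b → indicator b * f (Fin.suc i)) (eqF-suc i a))) ⟩
  0ℚ + Σ m (λ i → indicator (eqF i a) * f (Fin.suc i))
    ≡⟨ ℚ.+-identityˡ _ ⟩
  Σ m (λ i → indicator (eqF i a) * f (Fin.suc i))
    ≡⟨ Σ-δ m a (λ i → f (Fin.suc i)) ⟩
  f (Fin.suc a) ∎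
  where open ≡-Reasoning

module _ {m : ℕ} where

  infixr 7 _*ᵥ_
  infixl 7 _ᵥ*_

  _*ᵥ_ : Matrix m → Vector ℚ m → Vector ℚ m
  (M *ᵥ v) i = Σ m (λ j → M i j * v j)

  _ᵥ*_ : Vector ℚ m → Matrix m → Vector ℚ m
  (v ᵥ* M) j = Σ m (λ i → v i * M i j)

  ⟨_,_⟩ : Vector ℚ m → Vector ℚ m → ℚ
  ⟨ v , w ⟩ = Σ m (λ i → v i * w i)

  ·-*ᵥ : ∀ (A B : Matrix m) v i → ((A · B) *ᵥ v) i ≡ (A *ᵥ B *ᵥ v) i
  ·-*ᵥ A B v i = begin
    Σ m (λ k → Σ m (λ j → A i j * B j k) * v k)
      ≡⟨ Σ-cong m (λ k → sym (Σ-*ʳ m (v k) _)) ⟩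
    Σ m (λ k → Σ m (λ j → A i j * B j k * v k))
      ≡⟨ Σ-comm m m _ ⟩
    Σ m (λ j → Σ m (λ k → A i j * B j k * v k))
      ≡⟨ Σ-cong m (λ j → Σ-cong m (λ k → ℚ.*-assoc (A i j) (B j k) (v k))) ⟩
    Σ m (λ j → Σ m (λ k → A i j * (B j k * v k)))
      ≡⟨ Σ-cong m (λ j → Σ-*ˡ m (A i j) _) ⟩
    Σ m (λ j → A i j * Σ m (λ k → B j k * v k)) ∎
    where open ≡-Reasoning

  *ᵥ-ᵥ* : ∀ (A B : Matrix m) v j → ((A *ᵥ v) ᵥ* B) j ≡ (v ᵥ* (transpose A · B)) j
  *ᵥ-ᵥ* A B v j = begin
    Σ m (λ i → Σ m (λ k → A i k * v k) * B i j)
      ≡⟨ Σ-cong m (λ i → sym (Σ-*ʳ m (B i j) _)) ⟩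
    Σ m (λ i → Σ m (λ k → A i k * v k * B i j))
      ≡⟨ Σ-comm m m _ ⟩
    Σ m (λ k → Σ m (λ i → A i k * v k * B i j))
      ≡⟨ Σ-cong m (λ k → Σ-cong m (λ i →
           solve 3 (λ a x b → a :* x :* b := x :* (a :* b)) refl (A i k) (v k) (B i j))) ⟩
    Σ m (λ k → Σ m (λ i → v k * (A i k * B i j)))
      ≡⟨ Σ-cong m (λ k → Σ-*ˡ m (v k) _) ⟩
    Σ m (λ k → v k * Σ m (λ i → A i k * B i j)) ∎
    where open ≡-Reasoning

  ᵥ*-cong : ∀ {A B : Matrix m} v → A ≈ₘ B → ∀ j → (v ᵥ* A) j ≡ (v ᵥ* B) j
  ᵥ*-cong v A≈B j = Σ-cong m (λ i → cong (v i *_) (A≈B i j))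

  ᵥ*-symmetric : ∀ {M : Matrix m} → transpose M ≈ₘ M → ∀ v i → (v ᵥ* M) i ≡ (M *ᵥ v) i
  ᵥ*-symmetric {M} Mᵀ≈M v i =
    Σ-cong m (λ j → trans (ℚ.*-comm (v j) (M j i)) (cong (_* v j) (Mᵀ≈M i j)))

  ᵥ*-distrib-- : ∀ (M : Matrix m) v w j → ((λ i → v i - w i) ᵥ* M) j ≡ (v ᵥ* M) j - (w ᵥ* M) j
  ᵥ*-distrib-- M v w j = trans
    (Σ-cong m (λ i → solve 3 (λ x y a → (x :- y) :* a := x :* a :- y :* a) refl (v i) (w i) (M i j)))
    (Σ-- m _ _)

Reach-constant : ∀ {m} {adj : Fin m → Fin m → Bool} (g : Fin m → ℚ) →
  (∀ i j → T (adj i j) → g i ≡ g j) → ∀ {a b} → Reach adj a b → g a ≡ g b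
Reach-constant g g-adj here            = refl
Reach-constant g g-adj (step ab reach) = trans (g-adj _ _ ab) (Reach-constant g g-adj reach)

module Laplacian {m : ℕ} (adj : Fin m → Fin m → Bool) (adj-sym : ∀ a b → adj a b ≡ adj b a) where

  private
    A : Matrix m
    A i j = indicator (adj i j)

    L : Matrix m
    L = laplacian adj

  laplacian-symmetric : transpose L ≈ₘ L
  laplacian-symmetric i j with i Fin.≟ j | j Fin.≟ i
  ... | yes refl | yes _    = refl
  ... | yes refl | no  i≢i  = ⊥-elim (i≢i refl)
  ... | no  j≢i  | yes refl = ⊥-elim (j≢i refl)
  ... | no  _    | no  _    =
    cong₂ _-_ (trans (ℚ.*-zeroˡ (Σ m (A j))) (sym (ℚ.*-zeroˡ (Σ m (A i))))) (cong indicator (adj-sym j i))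

  laplacian-*ᵥ : ∀ v i → (L *ᵥ v) i ≡ Σ m (λ j → A i j * (v i - v j))
  laplacian-*ᵥ v i = begin
    Σ m (λ j → (indicator (eqF i j) * deg - A i j) * v j)
      ≡⟨ Σ-cong m (λ j → solve 4 (λ e d a w → (e :* d :- a) :* w := e :* (d :* w) :- a :* w) refl
           (indicator (eqF i j)) deg (A i j) (v j)) ⟩
    Σ m (λ j → indicator (eqF i j) * (deg * v j) - A i j * v j)
      ≡⟨ Σ-- m _ _ ⟩
    Σ m (λ j → indicator (eqF i j) * (deg * v j)) - Σ m (λ j → A i j * v j)
      ≡⟨ cong (_- Σ m (λ j → A i j * v j)) (begin
           Σ m (λ j → indicator (eqF i j) * (deg * v j))
             ≡⟨ Σ-cong m (λ j → cong (λ b → indicator b * (deg * v j)) (eqF-sym i j)) ⟩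
           Σ m (λ j → indicator (eqF j i) * (deg * v j))
             ≡⟨ Σ-δ m i (λ j → deg * v j) ⟩
           deg * v i
             ≡⟨ sym (Σ-*ʳ m (v i) (A i)) ⟩
           Σ m (λ j → A i j * v i) ∎) ⟩
    Σ m (λ j → A i j * v i) - Σ m (λ j → A i j * v j)
      ≡⟨ sym (Σ-- m _ _) ⟩
    Σ m (λ j → A i j * v i - A i j * v j)
      ≡⟨ Σ-cong m (λ j → solve 3 (λ a x y → a :* x :- a :* y := a :* (x :- y)) refl (A i j) (v i) (v j)) ⟩
    Σ m (λ j → A i j * (v i - v j)) ∎
    where
    open ≡-Reasoning
    deg : ℚ
    deg = Σ m (A i)

  dirichlet : Vector ℚ m → Vector ℚ m → ℚ
  dirichlet g h = Σ m (λ i → Σ m (λ j → A i j * ((g i - g j) * (h i - h j))))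

  2⟨g,L*ᵥh⟩≡dirichlet : ∀ g h → 2ℚ * ⟨ g , L *ᵥ h ⟩ ≡ dirichlet g h
  2⟨g,L*ᵥh⟩≡dirichlet g h = begin
    2ℚ * ⟨ g , L *ᵥ h ⟩
      ≡⟨ solve 1 (λ x → con 2ℚ :* x := x :+ x) refl ⟨ g , L *ᵥ h ⟩ ⟩
    ⟨ g , L *ᵥ h ⟩ + ⟨ g , L *ᵥ h ⟩
      ≡⟨ cong₂ _+_ ⟨g,L*ᵥh⟩≡forward (trans ⟨g,L*ᵥh⟩≡forward backward≡forward) ⟩
    Σ m (λ i → Σ m (forward i)) + Σ m (λ i → Σ m (backward i))
      ≡⟨ sym (trans (Σ-cong m (λ i → Σ-+ m (forward i) (backward i))) (Σ-+ m _ _)) ⟩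
    Σ m (λ i → Σ m (λ j → forward i j + backward i j))
      ≡⟨ Σ-cong m (λ i → Σ-cong m (λ j → solve 5 (λ a gi gj hi hj →
           a :* (gi :* (hi :- hj)) :+ a :* (gj :* (hj :- hi)) := a :* ((gi :- gj) :* (hi :- hj))) refl
           (A i j) (g i) (g j) (h i) (h j))) ⟩
    dirichlet g h ∎
    where
    open ≡-Reasoning
    forward backward : Fin m → Fin m → ℚ
    forward  i j = A i j * (g i * (h i - h j))
    backward i j = A i j * (g j * (h j - h i))

    ⟨g,L*ᵥh⟩≡forward : ⟨ g , L *ᵥ h ⟩ ≡ Σ m (λ i → Σ m (forward i))
    ⟨g,L*ᵥh⟩≡forward = Σ-cong m (λ i → begin
      g i * (L *ᵥ h) i
        ≡⟨ cong (g i *_) (laplacian-*ᵥ h i) ⟩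
      g i * Σ m (λ j → A i j * (h i - h j))
        ≡⟨ sym (Σ-*ˡ m (g i) _) ⟩
      Σ m (λ j → g i * (A i j * (h i - h j)))
        ≡⟨ Σ-cong m (λ j → solve 3 (λ x a d → x :* (a :* d) := a :* (x :* d)) refl (g i) (A i j) (h i - h j)) ⟩
      Σ m (forward i) ∎)

    backward≡forward : Σ m (λ i → Σ m (forward i)) ≡ Σ m (λ i → Σ m (backward i))
    backward≡forward = trans (Σ-comm m m forward)
      (Σ-cong m (λ i → Σ-cong m (λ j → cong (_* (g j * (h j - h i))) (cong indicator (adj-sym j i)))))

  private
    edge-energy-nonNeg : ∀ (g : Vector ℚ m) i j → 0ℚ ≤ℚ A i j * ((g i - g j) * (g i - g j))
    edge-energy-nonNeg g i j = *-nonNeg (indicator-nonNeg (adj i j)) (square-nonNeg (g i - g j))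

  dirichlet≡0⇒adj-constant : ∀ g → dirichlet g g ≡ 0ℚ → ∀ i j → T (adj i j) → g i ≡ g j
  dirichlet≡0⇒adj-constant g Dg≡0 i j i~j = begin
    g i                 ≡⟨ solve 2 (λ x y → x := (x :- y) :+ y) refl (g i) (g j) ⟩
    (g i - g j) + g j   ≡⟨ cong (_+ g j) (square≡0⇒≡0 (g i - g j) (trans (sym (ℚ.*-identityˡ _)) edge≡0)) ⟩
    0ℚ + g j            ≡⟨ ℚ.+-identityˡ (g j) ⟩
    g j                 ∎
    where
    open ≡-Reasoning
    row≡0 : Σ m (λ k → A i k * ((g i - g k) * (g i - g k))) ≡ 0ℚ
    row≡0 = nonNeg-Σ≡0⇒≡0 m (λ i → Σ-nonNeg m (edge-energy-nonNeg g i)) Dg≡0 i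
    edge≡0 : 1ℚ * ((g i - g j) * (g i - g j)) ≡ 0ℚ
    edge≡0 = trans (cong (_* ((g i - g j) * (g i - g j))) (sym (indicator-T i~j)))
                   (nonNeg-Σ≡0⇒≡0 m (edge-energy-nonNeg g i) row≡0 j)

  dirichlet-AM-GM : ∀ g h → 2ℚ * dirichlet g h ≤ℚ dirichlet g g + dirichlet h h
  dirichlet-AM-GM g h = subst₂ _≤ℚ_
    (trans (Σ-cong m (λ i → Σ-*ˡ m 2ℚ _)) (Σ-*ˡ m 2ℚ _))
    (trans (Σ-cong m (λ i → Σ-+ m _ _)) (Σ-+ m _ _))
    (Σ-mono-≤ m (λ i → Σ-mono-≤ m (λ j → edge i j)))
    where
    edge : ∀ i j → 2ℚ * (A i j * ((g i - g j) * (h i - h j))) ≤ℚ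
                   A i j * ((g i - g j) * (g i - g j)) + A i j * ((h i - h j) * (h i - h j))
    edge i j = subst₂ _≤ℚ_
      (solve 3 (λ a x y → a :* (con 2ℚ :* (x :* y)) := con 2ℚ :* (a :* (x :* y))) refl
        (A i j) (g i - g j) (h i - h j))
      (solve 3 (λ a x y → a :* (x :* x :+ y :* y) := a :* (x :* x) :+ a :* (y :* y)) refl
        (A i j) (g i - g j) (h i - h j))
      (indicator-*-mono-≤ (adj i j) (2pq≤p²+q² (g i - g j) (h i - h j)))

  dirichlet-* : ∀ c g h → dirichlet (λ i → c * g i) (λ i → c * h i) ≡ c * c * dirichlet g h
  dirichlet-* c g h = trans
    (Σ-cong m (λ i → trans (Σ-cong m (λ j →
      solve 6 (λ c a gi gj hi hj → a :* ((c :* gi :- c :* gj) :* (c :* hi :- c :* hj))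
                                  := c :* c :* (a :* ((gi :- gj) :* (hi :- hj))))
        refl c (A i j) (g i) (g j) (h i) (h j)))
      (Σ-*ˡ m (c * c) _)))
    (Σ-*ˡ m (c * c) _)

  Σ-L*ᵥ≡0 : ∀ h → Σ m (L *ᵥ h) ≡ 0ℚ
  Σ-L*ᵥ≡0 h = begin
    Σ m (L *ᵥ h)                          ≡⟨ Σ-cong m (λ i → sym (ℚ.*-identityˡ _)) ⟩
    ⟨ (λ _ → 1ℚ) , L *ᵥ h ⟩               ≡⟨ solve 1 (λ x → x := con ½ :* (con 2ℚ :* x)) refl _ ⟩
    ½ * (2ℚ * ⟨ (λ _ → 1ℚ) , L *ᵥ h ⟩)    ≡⟨ cong (½ *_) (2⟨g,L*ᵥh⟩≡dirichlet (λ _ → 1ℚ) h) ⟩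
    ½ * dirichlet (λ _ → 1ℚ) h            ≡⟨ cong (½ *_) dirichlet-1≡0 ⟩
    ½ * 0ℚ                                ≡⟨ ℚ.*-zeroʳ ½ ⟩
    0ℚ                                    ∎
    where
    open ≡-Reasoning
    dirichlet-1≡0 : dirichlet (λ _ → 1ℚ) h ≡ 0ℚ
    dirichlet-1≡0 = trans (Σ-cong m (λ i → trans (Σ-cong m (λ j →
        solve 2 (λ a d → a :* ((con 1ℚ :- con 1ℚ) :* d) := con 0ℚ) refl (A i j) (h i - h j)))
      (Σ-zero m))) (Σ-zero m)

  harmonic⇒constant : ∀ q → (∀ i → (L *ᵥ q) i ≡ 0ℚ) → ∀ {a b} → Reach adj a b → q a ≡ q b
  harmonic⇒constant q Lq≡0 = Reach-constant q (dirichlet≡0⇒adj-constant q (begin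
    dirichlet q q             ≡⟨ sym (2⟨g,L*ᵥh⟩≡dirichlet q q) ⟩
    2ℚ * ⟨ q , L *ᵥ q ⟩       ≡⟨ cong (2ℚ *_) (Σ-cong m (λ i → cong (q i *_) (Lq≡0 i))) ⟩
    2ℚ * Σ m (λ i → q i * 0ℚ) ≡⟨ cong (2ℚ *_) (trans (Σ-cong m (λ i → ℚ.*-zeroʳ (q i))) (Σ-zero m)) ⟩
    2ℚ * 0ℚ                   ≡⟨ ℚ.*-zeroʳ 2ℚ ⟩
    0ℚ                        ∎))
    where open ≡-Reasoning

  harmonic-Σ≡0⇒≡0 : (∀ a b → Reach adj a b) →
    ∀ q → (∀ i → (L *ᵥ q) i ≡ 0ℚ) → Σ m q ≡ 0ℚ → ∀ i → q i ≡ 0ℚ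
  harmonic-Σ≡0⇒≡0 connected q Lq≡0 Σq≡0 i =
    square≡0⇒≡0 (q i) (nonNeg-Σ≡0⇒≡0 m (λ k → square-nonNeg (q k)) Σq²≡0 i)
    where
    open ≡-Reasoning
    Σq²≡0 : Σ m (λ k → q k * q k) ≡ 0ℚ
    Σq²≡0 = begin
      Σ m (λ k → q k * q k)   ≡⟨ Σ-cong m (λ k → cong (_* q k) (harmonic⇒constant q Lq≡0 (connected k i))) ⟩
      Σ m (λ k → q i * q k)   ≡⟨ Σ-*ˡ m (q i) q ⟩
      q i * Σ m q             ≡⟨ cong (q i *_) Σq≡0 ⟩
      q i * 0ℚ                ≡⟨ ℚ.*-zeroʳ (q i) ⟩
      0ℚ                      ∎

  module _ (connected : ∀ a b → Reach adj a b) (X : Matrix m)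
           (LXL≈L : (L · X) · L ≈ₘ L) (LX-symmetric : transpose (L · X) ≈ₘ L · X) where

    L*ᵥX*ᵥ-ᵥ*L : ∀ v j → ((L *ᵥ X *ᵥ v) ᵥ* L) j ≡ (v ᵥ* L) j
    L*ᵥX*ᵥ-ᵥ*L v j = begin
      ((L *ᵥ X *ᵥ v) ᵥ* L) j              ≡⟨ Σ-cong m (λ k → cong (_* L k j) (sym (·-*ᵥ L X v k))) ⟩
      (((L · X) *ᵥ v) ᵥ* L) j             ≡⟨ *ᵥ-ᵥ* (L · X) L v j ⟩
      (v ᵥ* (transpose (L · X) · L)) j    ≡⟨ ᵥ*-cong v LXᵀL≈LXL j ⟩
      (v ᵥ* ((L · X) · L)) j              ≡⟨ ᵥ*-cong v LXL≈L j ⟩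
      (v ᵥ* L) j                          ∎
      where
      open ≡-Reasoning
      LXᵀL≈LXL : transpose (L · X) · L ≈ₘ (L · X) · L
      LXᵀL≈LXL k l = Σ-cong m (λ n → cong (_* L n l) (LX-symmetric k n))

    Σ≡0⇒L*ᵥX*ᵥu≡u : ∀ u → Σ m u ≡ 0ℚ → ∀ i → (L *ᵥ X *ᵥ u) i ≡ u i
    Σ≡0⇒L*ᵥX*ᵥu≡u u Σu≡0 i = begin
      (L *ᵥ X *ᵥ u) i          ≡⟨ solve 2 (λ x y → x := y :- (y :- x)) refl _ (u i) ⟩
      u i - residual i         ≡⟨ cong (λ z → u i - z) residual≡0 ⟩
      u i - 0ℚ                 ≡⟨ solve 1 (λ x → x :- con 0ℚ := x) refl (u i) ⟩
      u i                      ∎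
      where
      open ≡-Reasoning
      residual : Vector ℚ m
      residual k = u k - (L *ᵥ X *ᵥ u) k

      L*ᵥresidual≡0 : ∀ j → (L *ᵥ residual) j ≡ 0ℚ
      L*ᵥresidual≡0 j = begin
        (L *ᵥ residual) j                         ≡⟨ sym (ᵥ*-symmetric laplacian-symmetric residual j) ⟩
        (residual ᵥ* L) j                         ≡⟨ ᵥ*-distrib-- L u (L *ᵥ X *ᵥ u) j ⟩
        (u ᵥ* L) j - ((L *ᵥ X *ᵥ u) ᵥ* L) j       ≡⟨ cong (λ z → (u ᵥ* L) j - z) (L*ᵥX*ᵥ-ᵥ*L u j) ⟩
        (u ᵥ* L) j - (u ᵥ* L) j                   ≡⟨ ℚ.+-inverseʳ ((u ᵥ* L) j) ⟩
        0ℚ                                        ∎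

      Σresidual≡0 : Σ m residual ≡ 0ℚ
      Σresidual≡0 = trans (Σ-- m u _) (trans (cong₂ _-_ Σu≡0 (Σ-L*ᵥ≡0 (X *ᵥ u))) (ℚ.+-inverseʳ 0ℚ))

      residual≡0 : residual i ≡ 0ℚ
      residual≡0 = harmonic-Σ≡0⇒≡0 connected residual L*ᵥresidual≡0 Σresidual≡0 i

    resistance-lower-bound : ∀ s t (f : Vector ℚ m) →
      2ℚ * (2ℚ * (f s - f t)) ≤ℚ dirichlet f f + 2ℚ * quadForm X s t
    resistance-lower-bound s t f = subst₂ _≤ℚ_
      (cong (2ℚ *_) (trans (sym (2⟨g,L*ᵥh⟩≡dirichlet f y)) (cong (2ℚ *_) (⟨g,L*ᵥy⟩≡gs-gt f))))
      (cong (dirichlet f f +_) (trans (sym (2⟨g,L*ᵥh⟩≡dirichlet y y)) (cong (2ℚ *_) ⟨y,L*ᵥy⟩≡quadForm)))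
      (dirichlet-AM-GM f y)
      where
      open ≡-Reasoning
      u : Vector ℚ m
      u i = indicator (eqF i s) - indicator (eqF i t)

      ⟨g,u⟩≡gs-gt : ∀ g → ⟨ g , u ⟩ ≡ g s - g t
      ⟨g,u⟩≡gs-gt g = trans
        (Σ-cong m (λ i → solve 3 (λ x a b → x :* (a :- b) := a :* x :- b :* x) refl
          (g i) (indicator (eqF i s)) (indicator (eqF i t))))
        (trans (Σ-- m _ _) (cong₂ _-_ (Σ-δ m s g) (Σ-δ m t g)))

      Σu≡0 : Σ m u ≡ 0ℚ
      Σu≡0 = begin
        Σ m u                           ≡⟨ Σ-cong m (λ i → sym (ℚ.*-identityˡ (u i))) ⟩
        ⟨ (λ _ → 1ℚ) , u ⟩              ≡⟨ ⟨g,u⟩≡gs-gt (λ _ → 1ℚ) ⟩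
        1ℚ - 1ℚ                         ≡⟨ ℚ.+-inverseʳ 1ℚ ⟩
        0ℚ                              ∎

      y : Vector ℚ m
      y = X *ᵥ u

      ⟨g,L*ᵥy⟩≡gs-gt : ∀ g → ⟨ g , L *ᵥ y ⟩ ≡ g s - g t
      ⟨g,L*ᵥy⟩≡gs-gt g =
        trans (Σ-cong m (λ i → cong (g i *_) (Σ≡0⇒L*ᵥX*ᵥu≡u u Σu≡0 i))) (⟨g,u⟩≡gs-gt g)

      ⟨y,L*ᵥy⟩≡quadForm : ⟨ y , L *ᵥ y ⟩ ≡ quadForm X s t
      ⟨y,L*ᵥy⟩≡quadForm = begin
        ⟨ y , L *ᵥ y ⟩
          ≡⟨ Σ-cong m (λ i → cong (y i *_) (Σ≡0⇒L*ᵥX*ᵥu≡u u Σu≡0 i)) ⟩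
        Σ m (λ i → y i * u i)
          ≡⟨ Σ-cong m (λ i → trans (ℚ.*-comm (y i) (u i)) (sym (Σ-*ˡ m (u i) _))) ⟩
        Σ m (λ i → Σ m (λ j → u i * (X i j * u j)))
          ≡⟨ Σ-cong m (λ i → Σ-cong m (λ j → sym (ℚ.*-assoc (u i) (X i j) (u j)))) ⟩
        quadForm X s t ∎

data Near : ℕ → ℕ → Set where
  right₁ : ∀ {x} → Near x (suc x)
  right₂ : ∀ {x} → Near x (suc (suc x))
  left₁  : ∀ {y} → Near (suc y) y
  left₂  : ∀ {y} → Near (suc (suc y)) y

near-suc : ∀ {x y} → Near x y → Near (suc x) (suc y)
near-suc right₁ = right₁
near-suc right₂ = right₂
near-suc left₁  = left₁
near-suc left₂  = left₂

near : ∀ x y → 0 ℕ.< ℕ.∣ x - y ∣ → ℕ.∣ x - y ∣ ≤ 2 → Near x y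
near zero                zero                ()
near zero                (suc zero)          _ _ = right₁
near zero                (suc (suc zero))    _ _ = right₂
near zero                (suc (suc (suc _))) _ (s≤s (s≤s ()))
near (suc zero)          zero                _ _ = left₁
near (suc (suc zero))    zero                _ _ = left₂
near (suc (suc (suc _))) zero                _ (s≤s (s≤s ()))
near (suc x)             (suc y)             0<d d≤2 = near-suc (near x y 0<d d≤2)

near-distance²≤4 : ∀ {x y} → Near x y → (fromℕ x - fromℕ y) * (fromℕ x - fromℕ y) ≤ℚ fromℕ 4
near-distance²≤4 {x} right₁ = ℚ.≤-trans (ℚ.≤-reflexive
  (solve 1 (λ z → (z :- (con 1ℚ :+ z)) :* (z :- (con 1ℚ :+ z)) := con 1ℚ) refl (fromℕ x))) (ℚ.≤ᵇ⇒≤ tt)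
near-distance²≤4 {x} right₂ = ℚ.≤-reflexive
  (solve 1 (λ z → (z :- (con 1ℚ :+ (con 1ℚ :+ z))) :* (z :- (con 1ℚ :+ (con 1ℚ :+ z)))
                  := con (fromℕ 4)) refl (fromℕ x))
near-distance²≤4 {y = y} left₁ = ℚ.≤-trans (ℚ.≤-reflexive
  (solve 1 (λ z → ((con 1ℚ :+ z) :- z) :* ((con 1ℚ :+ z) :- z) := con 1ℚ) refl (fromℕ y))) (ℚ.≤ᵇ⇒≤ tt)
near-distance²≤4 {y = y} left₂ = ℚ.≤-reflexive
  (solve 1 (λ z → ((con 1ℚ :+ (con 1ℚ :+ z)) :- z) :* ((con 1ℚ :+ (con 1ℚ :+ z)) :- z)
                  := con (fromℕ 4)) refl (fromℕ y))

nearIndicator : Fin 4 → ℕ → ℕ → ℚ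
nearIndicator 0F x y = indicator (y ≡ᵇ suc x)
nearIndicator 1F x y = indicator (y ≡ᵇ suc (suc x))
nearIndicator 2F x y = indicator (suc y ≡ᵇ x)
nearIndicator 3F x y = indicator (suc (suc y) ≡ᵇ x)

nearIndicator-nonNeg : ∀ k x y → 0ℚ ≤ℚ nearIndicator k x y
nearIndicator-nonNeg 0F x y = indicator-nonNeg _
nearIndicator-nonNeg 1F x y = indicator-nonNeg _
nearIndicator-nonNeg 2F x y = indicator-nonNeg _
nearIndicator-nonNeg 3F x y = indicator-nonNeg _

near⇒nearIndicator≡1 : ∀ {x y} → Near x y → ∃[ k ] nearIndicator k x y ≡ 1ℚ
near⇒nearIndicator≡1 {x}     right₁ = 0F , indicator-T (ℕ.≡⇒≡ᵇ x x refl)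
near⇒nearIndicator≡1 {x}     right₂ = 1F , indicator-T (ℕ.≡⇒≡ᵇ x x refl)
near⇒nearIndicator≡1 {y = y} left₁  = 2F , indicator-T (ℕ.≡⇒≡ᵇ y y refl)
near⇒nearIndicator≡1 {y = y} left₂  = 3F , indicator-T (ℕ.≡⇒≡ᵇ y y refl)

near⇒1≤Σ-nearIndicator : ∀ {x y} → Near x y → 1ℚ ≤ℚ Σ 4 (λ k → nearIndicator k x y)
near⇒1≤Σ-nearIndicator {x} {y} near-xy with near⇒nearIndicator≡1 near-xy
... | k , hit = ℚ.≤-trans (ℚ.≤-reflexive (sym hit)) (Σ-term≤ 4 (λ k → nearIndicator-nonNeg k x y) k)

Σ-indicator-injective≤1 : ∀ m (e : Fin m → ℕ) → Injective _≡_ _≡_ e → ∀ c →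
  Σ m (λ b → indicator (e b ≡ᵇ c)) ≤ℚ 1ℚ
Σ-indicator-injective≤1 zero    e e-inj c = ℚ.≤ᵇ⇒≤ tt
Σ-indicator-injective≤1 (suc m) e e-inj c with e Fin.zero ≡ᵇ c in e₀≡ᵇc
... | false = subst (_≤ℚ 1ℚ) (sym (ℚ.+-identityˡ _))
  (Σ-indicator-injective≤1 m (λ b → e (Fin.suc b)) (λ eq → Fin.suc-injective (e-inj eq)) c)
... | true  = ℚ.≤-reflexive (trans (cong (1ℚ +_) (trans (Σ-cong m others) (Σ-zero m))) (ℚ.+-identityʳ 1ℚ))
  where
  others : ∀ b → indicator (e (Fin.suc b) ≡ᵇ c) ≡ 0ℚ
  others b with e (Fin.suc b) ≡ᵇ c in eb≡ᵇc
  ... | false = refl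
  ... | true with e-inj (trans (ℕ.≡ᵇ⇒≡ _ c (subst T (sym eb≡ᵇc) tt))
                             (sym (ℕ.≡ᵇ⇒≡ _ c (subst T (sym e₀≡ᵇc) tt))))
  ...   | ()

Σ-nearIndicator-injective≤1 : ∀ m (e : Fin m → ℕ) → Injective _≡_ _≡_ e → ∀ k x →
  Σ m (λ b → nearIndicator k x (e b)) ≤ℚ 1ℚ
Σ-nearIndicator-injective≤1 m e e-inj 0F x = Σ-indicator-injective≤1 m e e-inj (suc x)
Σ-nearIndicator-injective≤1 m e e-inj 1F x = Σ-indicator-injective≤1 m e e-inj (suc (suc x))
Σ-nearIndicator-injective≤1 m e e-inj 2F x =
  Σ-indicator-injective≤1 m (λ b → suc (e b)) (λ eq → e-inj (ℕ.suc-injective eq)) x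
Σ-nearIndicator-injective≤1 m e e-inj 3F x =
  Σ-indicator-injective≤1 m (λ b → suc (suc (e b))) (λ eq → e-inj (ℕ.suc-injective (ℕ.suc-injective eq))) x

edge-distance²≤4*nearness : ∀ b x y → (T b → 0 ℕ.< ℕ.∣ x - y ∣ × ℕ.∣ x - y ∣ ≤ 2) →
  indicator b * ((fromℕ x - fromℕ y) * (fromℕ x - fromℕ y)) ≤ℚ fromℕ 4 * Σ 4 (λ k → nearIndicator k x y)
edge-distance²≤4*nearness false x y _ = subst₂ _≤ℚ_
  (trans (ℚ.*-zeroʳ (fromℕ 4)) (sym (ℚ.*-zeroˡ ((fromℕ x - fromℕ y) * (fromℕ x - fromℕ y))))) refl
  (ℚ.*-monoˡ-≤-nonNeg (fromℕ 4) (Σ-nonNeg 4 (λ k → nearIndicator-nonNeg k x y)))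
edge-distance²≤4*nearness true x y adjacent = begin
  1ℚ * ((fromℕ x - fromℕ y) * (fromℕ x - fromℕ y))   ≡⟨ ℚ.*-identityˡ _ ⟩
  (fromℕ x - fromℕ y) * (fromℕ x - fromℕ y)          ≤⟨ near-distance²≤4 near-xy ⟩
  fromℕ 4 * 1ℚ                                       ≤⟨ ℚ.*-monoˡ-≤-nonNeg _ (near⇒1≤Σ-nearIndicator near-xy) ⟩
  fromℕ 4 * Σ 4 (λ k → nearIndicator k x y)          ∎
  where
  open ℚ.≤-Reasoning
  near-xy : Near x y
  near-xy = near x y (proj₁ (adjacent tt)) (proj₂ (adjacent tt))

module _ {n : ℕ} (H : ConnSubgraph n) where
  open ConnSubgraph H
  open Laplacian adj adj-sym

  position : Vector ℚ m
  position a = fromℕ (toℕ (emb a))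

  dirichlet-position≤16m : dirichlet position position ≤ℚ fromℕ m * fromℕ 16
  dirichlet-position≤16m = ℚ.≤-trans (Σ-mono-≤ m vertex-energy≤16) (ℚ.≤-reflexive (Σ-const m (fromℕ 16)))
    where
    e : Fin m → ℕ
    e a = toℕ (emb a)

    e-injective : Injective _≡_ _≡_ e
    e-injective eq = emb-inj (Fin.toℕ-injective eq)

    vertex-energy≤16 : ∀ a →
      Σ m (λ b → indicator (adj a b) * ((position a - position b) * (position a - position b))) ≤ℚ fromℕ 16
    vertex-energy≤16 a = begin
      Σ m (λ b → indicator (adj a b) * ((position a - position b) * (position a - position b)))
        ≤⟨ Σ-mono-≤ m (λ b → edge-distance²≤4*nearness (adj a b) (e a) (e b) (adj-sub a b)) ⟩
      Σ m (λ b → fromℕ 4 * Σ 4 (λ k → nearIndicator k (e a) (e b)))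
        ≡⟨ Σ-*ˡ m (fromℕ 4) _ ⟩
      fromℕ 4 * Σ m (λ b → Σ 4 (λ k → nearIndicator k (e a) (e b)))
        ≡⟨ cong (fromℕ 4 *_) (Σ-comm m 4 (λ b k → nearIndicator k (e a) (e b))) ⟩
      fromℕ 4 * Σ 4 (λ k → Σ m (λ b → nearIndicator k (e a) (e b)))
        ≤⟨ ℚ.*-monoˡ-≤-nonNeg (fromℕ 4)
             (Σ-mono-≤ 4 (λ k → Σ-nearIndicator-injective≤1 m e e-injective k (e a))) ⟩
      fromℕ 4 * Σ 4 (λ _ → 1ℚ)
        ≡⟨⟩
      fromℕ 16 ∎
      where open ℚ.≤-Reasoning

  resistance1n-lower-bound : ∀ X → IsMPInverse L[ H ] X →
    fromℕ n ≤ℚ fromℕ 2 + fromℕ 8 * resistance1n H X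
  resistance1n-lower-bound X (LXL≈L , _ , LX-symmetric , _) = subst (_≤ℚ fromℕ 2 + fromℕ 8 * r)
    (cong fromℕ t-last) (0≤q-p⇒p≤q (subst (0ℚ ≤ℚ_) slack≡ slack-nonNeg))
    where
    K : ℕ
    K = toℕ (emb t)

    r D ⅛ : ℚ
    r = resistance1n H X
    D = dirichlet position position
    ⅛ = 1/ fromℕ 8

    f : Vector ℚ m
    f a = - ⅛ * position a

    drop : f s - f t ≡ ⅛ * fromℕ K
    drop = trans (cong (λ z → - ⅛ * fromℕ z - - ⅛ * fromℕ K) s-first)
      (solve 2 (λ c k → :- c :* con 0ℚ :- :- c :* k := c :* k) refl ⅛ (fromℕ K))

    thomson : 2ℚ * (2ℚ * (⅛ * fromℕ K)) ≤ℚ ⅛ * ⅛ * D + 2ℚ * r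
    thomson = subst₂ (λ a b → 2ℚ * (2ℚ * a) ≤ℚ b + 2ℚ * r) drop (dirichlet-* (- ⅛) position position)
      (resistance-lower-bound connected X LXL≈L LX-symmetric s t f)

    energy : D ≤ℚ (1ℚ + fromℕ K) * fromℕ 16
    energy = ℚ.≤-trans dirichlet-position≤16m (ℚ.*-monoʳ-≤-nonNeg (fromℕ 16)
      (fromℕ-mono-≤ (subst (m ≤_) (sym t-last) (Fin.injective⇒≤ emb-inj))))

    -- The scaling 1/8 of the potential balances the drop against the energy; the
    -- coefficients 4 and 1/16 below combine the two slacks into exactly 2 + 8 r − n.
    slack-nonNeg : 0ℚ ≤ℚ fromℕ 4 * (⅛ * ⅛ * D + 2ℚ * r - 2ℚ * (2ℚ * (⅛ * fromℕ K)))
                         + 1/ fromℕ 16 * ((1ℚ + fromℕ K) * fromℕ 16 - D)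
    slack-nonNeg = +-nonNeg (*-nonNeg (fromℕ-nonNeg 4) (p≤q⇒0≤q-p thomson))
                            (*-nonNeg {1/ fromℕ 16} (ℚ.≤ᵇ⇒≤ tt) (p≤q⇒0≤q-p energy))

    slack≡ : fromℕ 4 * (⅛ * ⅛ * D + 2ℚ * r - 2ℚ * (2ℚ * (⅛ * fromℕ K)))
               + 1/ fromℕ 16 * ((1ℚ + fromℕ K) * fromℕ 16 - D)
             ≡ fromℕ 2 + fromℕ 8 * r - (1ℚ + fromℕ K)
    slack≡ = solve 3 (λ D r k →
        con (fromℕ 4) :* (con ⅛ :* con ⅛ :* D :+ con 2ℚ :* r :- con 2ℚ :* (con 2ℚ :* (con ⅛ :* k)))
          :+ con (1/ fromℕ 16) :* ((con 1ℚ :+ k) :* con (fromℕ 16) :- D)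
        := con (fromℕ 2) :+ con (fromℕ 8) :* r :- (con 1ℚ :+ k))
      refl D r (fromℕ K)

corollary1p3 : (H : (n : ℕ) → 3 ≤ n → ConnSubgraph n)
    (X : (n : ℕ) (p : 3 ≤ n) → Matrix (ConnSubgraph.m (H n p)))
    → ((n : ℕ) (p : 3 ≤ n) → IsMPInverse (L[ H n p ]) (X n p))
    → (M : ℚ) → ∃[ N ] ((n : ℕ) (p : 3 ≤ n) → N ≤ n
    → M ≤ℚ resistance1n (H n p) (X n p))
corollary1p3 H X X-MP M with fromℕ-unbounded M
... | B , M≤B = 2 ℕ.+ 8 ℕ.* B , λ n p N≤n →
  ℚ.≤-trans M≤B (+-*-cancelˡ-≤ (fromℕ 2) (fromℕ 8) (begin
  fromℕ 2 + fromℕ 8 * fromℕ B                        ≡⟨ cong (fromℕ 2 +_) (sym (fromℕ-* 8 B)) ⟩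
  fromℕ 2 + fromℕ (8 ℕ.* B)                          ≡⟨ sym (fromℕ-+ 2 (8 ℕ.* B)) ⟩
  fromℕ (2 ℕ.+ 8 ℕ.* B)                              ≤⟨ fromℕ-mono-≤ N≤n ⟩
  fromℕ n                                            ≤⟨ resistance1n-lower-bound (H n p) (X n p) (X-MP n p) ⟩
  fromℕ 2 + fromℕ 8 * resistance1n (H n p) (X n p)   ∎))
  where open ℚ.≤-Reasoning
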